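{- Let $m\ge 3$, $n\geq 3$ and $2\leq l\leq n-1$. Then $\chi_{(B(m,n),\sigma_l)}(\lambda)=\gamma_m^{n-l}\chi_{B^{uv}(m,l)}(\lambda)$, where $\gamma_m=\frac{(\lambda-1)^{m-1}-(-1)^{m-1}}{\lambda}$.
   Context: The book graph $B(m,n)$ has vertices $\{u,v\}\cup\{u_j^i:1\le i\le n,1\le j\le m-2\}$ and consists of the $n$ cycles $uu_1^i\cdots u_{m-2}^ivu$ sharing the edge $uv$. For $1\le l\le n$, $\sigma_l=\{uu_1^1,\ldots,uu_1^l\}$ is the set of negative edges of the signed graph $(B(m,n),\sigma_l)$; $B^{uv}(m,l)$ denotes the signed graph on $B(m,l)$ whose only negative edge is $uv$. For a signed graph with sign function $\sigma$, a proper coloring with colors $\{ -k,\ldots,0,\ldots,k\}$ is a map $c$ with $c(x)\ne\sigma(e)c(y)$ for each edge $e=xy$; the chromatic polynomial is the polynomial whose value at $\lambda=2k+1$ counts proper colorings. -}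

module Defs where

open import Data.Nat as ℕ using (ℕ; zero; suc; _∸_)
open import Data.Integer as ℤ using (ℤ; +_; -_; _-_; _^_; _/_)
open import Data.Fin as Fin using (Fin; toℕ; combine; _↑ʳ_)
open import Data.Bool using (Bool; true; false; if_then_else_; not; _∧_)
open import Data.List as List using (List; []; _∷_; _++_; map; concatMap; allFin; foldr; concat)
open import Data.Vec using (Vec; []; _∷_; lookup)
open import Data.Product using (_×_; _,_)
open import Relation.Nullary using (does)
open import Data.Nat.ListAction using (sum)

-- A signed graph on vertex set Fin N: a list of edges (x , y , negative?).
-- The Bool component is true iff the edge is negative (sigma(e) = -1).
record SignedGraph : Set where
  constructor sgraph
  field
    nV    : ℕ
    edges : List (Fin nV × Fin nV × Bool)
open SignedGraph public

consecutive : {A : Set} → List A → List (A × A)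
consecutive []             = []
consecutive (x ∷ [])       = []
consecutive (x ∷ y ∷ xs)   = (x , y) ∷ consecutive (y ∷ xs)

-- Book graph B(m,n): vertices u = 0, v = 1, u^i_j ↦ 2 + combine i j
-- (i : Fin n for 1 ≤ i ≤ n, j : Fin (m ∸ 2) for 1 ≤ j ≤ m-2).
bookV : ℕ → ℕ → ℕ
bookV m n = 2 ℕ.+ n ℕ.* (m ∸ 2)

bU : ∀ {m n} → Fin (bookV m n)
bU = Fin.zero

bV : ∀ {m n} → Fin (bookV m n)
bV = Fin.suc Fin.zero

bX : ∀ {m n} → Fin n → Fin (m ∸ 2) → Fin (bookV m n)
bX {m} {n} i j = 2 ↑ʳ combine i j

-- the i-th cycle u u^i_1 ... u^i_{m-2} v as a path (the edge uv is added once)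
cyclePath : ∀ m n → Fin n → List (Fin (bookV m n))
cyclePath m n i = bU {m} {n} ∷ (map (bX {m} {n} i) (allFin (m ∸ 2)) List.++ (bV {m} {n} ∷ []))

-- Book graph with a sign assignment: `negPath i x y` decides the sign of the
-- path edge xy in cycle i, `negUV` the sign of uv.
bookSigned : (m n : ℕ) → (Fin n → Fin (bookV m n) → Fin (bookV m n) → Bool) → Bool → SignedGraph
bookSigned m n negPath negUV =
  sgraph (bookV m n)
    ((bU {m} {n} , bV {m} {n} , negUV) ∷
      concatMap (λ i → map (λ { (x , y) → (x , y , negPath i x y) }) (consecutive (cyclePath m n i))) (allFin n))

isFirst : ∀ {N} → Fin N → Fin N → Bool
isFirst Fin.zero Fin.zero = true
isFirst _ _ = false

-- (B(m,n), σ_l): negative edges are u u^i_1 for 1 ≤ i ≤ l, i.e. toℕ i < l.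
-- In cyclePath i, the edge u u^i_1 is the unique path edge whose first endpoint is u.
bookσ : (m n l : ℕ) → SignedGraph
bookσ m n l = bookSigned m n (λ i x y → does (toℕ i ℕ.<? l) ∧ isFirst x (bU {m} {n})) false

-- B^{uv}(m,l): B(m,l) whose only negative edge is uv.
bookUV : (m l : ℕ) → SignedGraph
bookUV m l = bookSigned m l (λ _ _ _ → false) true

-- colour set {-k,...,k}: Fin (2k+1) with a ↦ a - k
colourVal : (k : ℕ) → Fin (suc (2 ℕ.* k)) → ℤ
colourVal k a = + toℕ a - + k

allVecs : (c N : ℕ) → List (Vec (Fin c) N)
allVecs c zero    = [] ∷ []
allVecs c (suc N) = concatMap (λ a → map (a ∷_) (allVecs c N)) (allFin c)

edgeOK : (k : ℕ) → ∀ {N} → Vec (Fin (suc (2 ℕ.* k))) N → Fin N × Fin N × Bool → Bool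
edgeOK k col (x , y , neg) =
  not (does (colourVal k (lookup col x) ℤ.≟ (if neg then - colourVal k (lookup col y) else colourVal k (lookup col y))))

isProper : (k : ℕ) → (G : SignedGraph) → Vec (Fin (suc (2 ℕ.* k))) (nV G) → Bool
isProper k G col = foldr (λ e b → edgeOK k col e ∧ b) true (edges G)

-- number of proper colourings of G with colours {-k,...,k}, i.e. χ_G(2k+1)
numColourings : (k : ℕ) → SignedGraph → ℕ
numColourings k G =
  sum (map (λ col → if isProper k G col then 1 else 0) (allVecs (suc (2 ℕ.* k)) (nV G)))

-- γ_m(λ) = ((λ-1)^(m-1) - (-1)^(m-1)) / λ evaluated at λ = 2k+1
gamma : (m k : ℕ) → ℤ
gamma m k = ((+ (2 ℕ.* k)) ^ (m ∸ 1) - (- + 1) ^ (m ∸ 1)) / (+ suc (2 ℕ.* k))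

-- Fix the colours a of u and b of v. The pages of the book then impose independent
-- conditions, so the count factorises into a product over the pages of the number of
-- proper colourings of a path u x₁ … x_{m-2} v with end colours a and b. Identifying the
-- colours {-k,…,k} with Fin (2k+1), negation becomes `opposite`, so a negative first edge
-- u x₁ just replaces a by its negative, and a page counts the walks from ±a to b with
-- m-2 inner vertices in the complete graph on λ = 2k+1 vertices. These numbers W_t satisfy
-- W_{t+1} + W_t = (λ-1)^{t+1}, whence λ W_{m-2} = (λ-1)^{m-1} - (-1)^{m-1} for a ≠ b: every
-- positive page contributes γ_m. For (B(m,n),σ_l) the term of (a,b) is therefore
-- [a ≠ b] W(-a,b)^l γ_m^{n-l}, while for B^{uv}(m,l) it is [-a ≠ b] W(a,b)^l, and the
-- substitution a ↦ -a turns the latter sum into the former without the factor γ_m^{n-l}.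

module Submission where

open import Defs
open import Data.Bool using (Bool; true; false; if_then_else_; not; _∧_)
open import Data.Bool.Properties using (∧-assoc; ∧-identityʳ; ∧-zeroʳ)
open import Data.Fin using (Fin; toℕ; combine; opposite)
open import Data.Fin.Permutation using (reverse)
open import Data.Fin.Properties using (_≟_; opposite-prop; opposite-involutive; toℕ<n; toℕ-injective)
open import Data.Integer as ℤ using (ℤ; +_; -_; _-_)
import Data.Integer.Properties as ZP
open import Data.Integer.Tactic.RingSolver using (solve-∀)
open import Data.List as List using (List; []; _∷_; _++_; map; concatMap; foldr)
open import Data.List.Properties using (map-++; map-∘; map-tabulate)
open import Data.Nat as ℕ using (ℕ; zero; suc; _+_; _*_; _^_; _∸_; _≤_; _<?_; z≤n; s≤s; s≤s⁻¹)
open import Data.Nat.DivMod using (m*n/n≡m)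
open import Data.Nat.ListAction using () renaming (sum to sumList)
open import Data.Nat.ListAction.Properties using () renaming (sum-++ to sumList-++)
open import Data.Nat.Properties
  using (+-*-semiring; +-identityʳ; +-assoc; +-comm; *-identityˡ; *-identityʳ; *-assoc; *-comm;
         +-cancelʳ-≡; m∸n+n≡m; m∸n≤m; ≤-trans)
open import Algebra.Properties.Semiring.Sum +-*-semiring
  using (sum-syntax; sum-cong-≗; *-distribˡ-sum; ∑-distrib-+; ∑-permute)
open import Data.Product using (_×_; _,_)
open import Data.Vec as Vec using (Vec; []; _∷_; lookup)
open import Data.Vec.Properties using (tabulate-cong; tabulate∘lookup; lookup-++ˡ; lookup-++ʳ)
open import Function using (_∘_; _⇔_; mk⇔)
open import Relation.Nullary using (does; yes; no)
open import Relation.Nullary.Decidable using (does-⇔; dec-false)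
open import Relation.Binary.PropositionalEquality
open ≡-Reasoning

indicator : Bool → ℕ
indicator b = if b then 1 else 0

indicator-∧ : ∀ x y → indicator (x ∧ y) ≡ indicator x * indicator y
indicator-∧ true  y = sym (+-identityʳ (indicator y))
indicator-∧ false y = refl

∑-const : ∀ n x → ∑[ i < n ] x ≡ n * x
∑-const zero    x = refl
∑-const (suc n) x = cong (_+_ x) (∑-const n x)

∑-except : ∀ {n} (a : Fin n) (f : Fin n → ℕ) →
  ∑[ x < n ] (indicator (not (does (a ≟ x))) * f x) + f a ≡ ∑[ x < n ] f x
∑-except {suc n} Fin.zero f =
  trans (cong (_+ f Fin.zero) (sum-cong-≗ (λ x → +-identityʳ (f (Fin.suc x)))))
        (+-comm _ (f Fin.zero))
∑-except {suc n} (Fin.suc a) f =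
  trans (+-assoc (f Fin.zero + 0) _ (f (Fin.suc a)))
        (cong₂ _+_ (+-identityʳ (f Fin.zero)) (∑-except a (f ∘ Fin.suc)))

∏ : ∀ n → (Fin n → ℕ) → ℕ
∏ zero    f = 1
∏ (suc n) f = f Fin.zero * ∏ n (f ∘ Fin.suc)

syntax ∏ n (λ i → x) = ∏[ i < n ] x

∏-cong : ∀ {n} {f g : Fin n → ℕ} → (∀ i → f i ≡ g i) → ∏ n f ≡ ∏ n g
∏-cong {zero}  eq = refl
∏-cong {suc n} eq = cong₂ _*_ (eq Fin.zero) (∏-cong (eq ∘ Fin.suc))

∏-const : ∀ n x → ∏[ i < n ] x ≡ x ^ n
∏-const zero    x = refl
∏-const (suc n) x = cong (x *_) (∏-const n x)

∏-below : ∀ {n l} (h : Bool → ℕ) → l ≤ n →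
  ∏[ i < n ] h (does (toℕ i <? l)) ≡ h true ^ l * h false ^ (n ∸ l)
∏-below {zero}  h z≤n = refl
∏-below {suc n} h z≤n =
  trans (cong (h false *_) (trans (∏-below {n} h z≤n) (*-identityˡ _))) (sym (*-identityˡ _))
∏-below {suc n} h (s≤s l≤n) =
  trans (cong (h true *_) (∏-below h l≤n)) (sym (*-assoc (h true) _ _))

pos-∑-scale : ∀ {n} (z : ℤ) {f g : Fin n → ℕ} → (∀ i → + f i ≡ z ℤ.* + g i) →
  + ∑[ i < n ] f i ≡ z ℤ.* + ∑[ i < n ] g i
pos-∑-scale {zero}  z eq = sym (ZP.*-zeroʳ z)
pos-∑-scale {suc n} z {f} {g} eq = begin
  + (f Fin.zero + ∑[ i < n ] f (Fin.suc i))
    ≡⟨ ZP.pos-+ (f Fin.zero) _ ⟩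
  + f Fin.zero ℤ.+ + ∑[ i < n ] f (Fin.suc i)
    ≡⟨ cong₂ ℤ._+_ (eq Fin.zero) (pos-∑-scale z (eq ∘ Fin.suc)) ⟩
  z ℤ.* + g Fin.zero ℤ.+ z ℤ.* + ∑[ i < n ] g (Fin.suc i)
    ≡⟨ ZP.*-distribˡ-+ z _ _ ⟨
  z ℤ.* (+ g Fin.zero ℤ.+ + ∑[ i < n ] g (Fin.suc i))
    ≡⟨ cong (z ℤ.*_) (ZP.pos-+ (g Fin.zero) _) ⟨
  z ℤ.* + ∑[ i < suc n ] g i
    ∎

∑Vec : ∀ c N → (Vec (Fin c) N → ℕ) → ℕ
∑Vec c zero    f = f []
∑Vec c (suc N) f = ∑[ a < c ] ∑Vec c N (λ v → f (a ∷ v))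

sumList-concatMap-tabulate : ∀ {A B : Set} {n} (f : A → ℕ) (G : B → List A) (h : Fin n → B) →
  sumList (map f (concatMap G (List.tabulate h))) ≡ ∑[ i < n ] sumList (map f (G (h i)))
sumList-concatMap-tabulate {n = zero}  f G h = refl
sumList-concatMap-tabulate {n = suc n} f G h = begin
  sumList (map f (G (h Fin.zero) ++ concatMap G (List.tabulate (h ∘ Fin.suc))))
    ≡⟨ cong sumList (map-++ f (G (h Fin.zero)) _) ⟩
  sumList (map f (G (h Fin.zero)) ++ map f (concatMap G (List.tabulate (h ∘ Fin.suc))))
    ≡⟨ sumList-++ (map f (G (h Fin.zero))) _ ⟩
  sumList (map f (G (h Fin.zero))) + sumList (map f (concatMap G (List.tabulate (h ∘ Fin.suc))))
    ≡⟨ cong (_+_ (sumList (map f (G (h Fin.zero))))) (sumList-concatMap-tabulate f G (h ∘ Fin.suc)) ⟩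
  ∑[ i < suc n ] sumList (map f (G (h i)))
    ∎

sumList-allVecs : ∀ c N (f : Vec (Fin c) N → ℕ) → sumList (map f (allVecs c N)) ≡ ∑Vec c N f
sumList-allVecs c zero    f = +-identityʳ (f [])
sumList-allVecs c (suc N) f =
  trans (sumList-concatMap-tabulate f (λ a → map (a ∷_) (allVecs c N)) (λ a → a))
        (sum-cong-≗ (λ a → trans (cong sumList (sym (map-∘ (allVecs c N))))
                                 (sumList-allVecs c N (λ v → f (a ∷ v)))))

∑Vec-cong : ∀ c N {f g : Vec (Fin c) N → ℕ} → (∀ v → f v ≡ g v) → ∑Vec c N f ≡ ∑Vec c N g
∑Vec-cong c zero    eq = eq []
∑Vec-cong c (suc N) eq = sum-cong-≗ (λ a → ∑Vec-cong c N (λ v → eq (a ∷ v)))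

*-distribˡ-∑Vec : ∀ c N x (f : Vec (Fin c) N → ℕ) → x * ∑Vec c N f ≡ ∑Vec c N (λ v → x * f v)
*-distribˡ-∑Vec c zero    x f = refl
*-distribˡ-∑Vec c (suc N) x f =
  trans (*-distribˡ-sum x (λ a → ∑Vec c N (λ v → f (a ∷ v))))
        (sum-cong-≗ (λ a → *-distribˡ-∑Vec c N x (λ v → f (a ∷ v))))

∑Vec-++ : ∀ c M N (f : Vec (Fin c) (M + N) → ℕ) →
  ∑Vec c (M + N) f ≡ ∑Vec c M (λ x → ∑Vec c N (λ y → f (x Vec.++ y)))
∑Vec-++ c zero    N f = refl
∑Vec-++ c (suc M) N f = sum-cong-≗ (λ a → ∑Vec-++ c M N (λ v → f (a ∷ v)))

∑Vec-*-∑Vec : ∀ c M N (f : Vec (Fin c) M → ℕ) (g : Vec (Fin c) N → ℕ) →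
  ∑Vec c M (λ x → ∑Vec c N (λ y → f x * g y)) ≡ ∑Vec c M f * ∑Vec c N g
∑Vec-*-∑Vec c M N f g = begin
  ∑Vec c M (λ x → ∑Vec c N (λ y → f x * g y)) ≡⟨ ∑Vec-cong c M (λ x → *-distribˡ-∑Vec c N (f x) g) ⟨
  ∑Vec c M (λ x → f x * ∑Vec c N g)           ≡⟨ ∑Vec-cong c M (λ x → *-comm (f x) _) ⟩
  ∑Vec c M (λ x → ∑Vec c N g * f x)           ≡⟨ *-distribˡ-∑Vec c M (∑Vec c N g) f ⟨
  ∑Vec c N g * ∑Vec c M f                     ≡⟨ *-comm _ (∑Vec c M f) ⟩
  ∑Vec c M f * ∑Vec c N g                     ∎

-- The colours of u^i_1 … u^i_{m-2} in a colouring a ∷ b ∷ v of B(m,n) (cf. bX).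
page : ∀ {A : Set} {n p} → Vec A (n * p) → Fin n → Vec A p
page v i = Vec.tabulate (λ j → lookup v (combine i j))

page-++-zero : ∀ {A : Set} {n p} (x : Vec A p) (y : Vec A (n * p)) → page {n = suc n} {p} (x Vec.++ y) Fin.zero ≡ x
page-++-zero x y = trans (tabulate-cong (lookup-++ˡ x y)) (tabulate∘lookup x)

page-++-suc : ∀ {A : Set} {n p} (x : Vec A p) (y : Vec A (n * p)) i → page {n = suc n} {p} (x Vec.++ y) (Fin.suc i) ≡ page {n = n} y i
page-++-suc x y i = tabulate-cong (λ j → lookup-++ʳ x y (combine i j))

∑Vec-∏-pages : ∀ c n p (f : Fin n → Vec (Fin c) p → ℕ) →
  ∑Vec c (n * p) (λ v → ∏[ i < n ] f i (page {n = n} v i)) ≡ ∏[ i < n ] ∑Vec c p (f i)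
∑Vec-∏-pages c zero    p f = refl
∑Vec-∏-pages c (suc n) p f = begin
  ∑Vec c (p + n * p) (λ v → ∏[ i < suc n ] f i (page {n = suc n} v i))
    ≡⟨ ∑Vec-++ c p (n * p) _ ⟩
  ∑Vec c p (λ x → ∑Vec c (n * p) (λ y → ∏[ i < suc n ] f i (page {n = suc n} (x Vec.++ y) i)))
    ≡⟨ ∑Vec-cong c p (λ x → ∑Vec-cong c (n * p) (λ y → cong₂ _*_
         (cong (f Fin.zero) (page-++-zero {n = n} x y))
         (∏-cong (λ i → cong (f (Fin.suc i)) (page-++-suc x y i))))) ⟩
  ∑Vec c p (λ x → ∑Vec c (n * p) (λ y → f Fin.zero x * ∏[ i < n ] f (Fin.suc i) (page {n = n} y i)))
    ≡⟨ ∑Vec-*-∑Vec c p (n * p) (f Fin.zero) _ ⟩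
  ∑Vec c p (f Fin.zero) * ∑Vec c (n * p) (λ y → ∏[ i < n ] f (Fin.suc i) (page {n = n} y i))
    ≡⟨ cong (_*_ (∑Vec c p (f Fin.zero))) (∑Vec-∏-pages c n p (f ∘ Fin.suc)) ⟩
  ∏[ i < suc n ] ∑Vec c p (f i)
    ∎

-- Signed colours

reflect : ∀ {n} → Bool → Fin n → Fin n
reflect s a = if s then opposite a else a

compatible : ∀ {n} → Bool → Fin n → Fin n → Bool
compatible s a b = not (does (reflect s a ≟ b))

colourVal-opposite : ∀ k (a : Fin (suc (2 * k))) → colourVal k (opposite a) ≡ - colourVal k a
colourVal-opposite k a = begin
  + o - + k                  ≡⟨ regroup (+ o) (+ t) (+ k) ⟩
  (+ o ℤ.+ + t) - + t - + k  ≡⟨ cong (λ z → z - + t - + k) o+t≡k+k ⟩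
  (+ k ℤ.+ + k) - + t - + k  ≡⟨ reflectAround (+ t) (+ k) ⟩
  - (+ t - + k)              ∎
  where
  o = toℕ (opposite a)
  t = toℕ a
  o+t≡k+k : + o ℤ.+ + t ≡ + k ℤ.+ + k
  o+t≡k+k = begin
    + o ℤ.+ + t        ≡⟨ ZP.pos-+ o t ⟨
    + (o + t)          ≡⟨ cong (λ z → + (z + t)) (opposite-prop a) ⟩
    + (2 * k ∸ t + t)  ≡⟨ cong +_ (m∸n+n≡m (s≤s⁻¹ (toℕ<n a))) ⟩
    + (k + (k + 0))    ≡⟨ cong (λ z → + (k + z)) (+-identityʳ k) ⟩
    + (k + k)          ≡⟨ ZP.pos-+ k k ⟩
    + k ℤ.+ + k        ∎
  regroup : ∀ o t k → o - k ≡ (o ℤ.+ t) - t - k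
  regroup = solve-∀
  reflectAround : ∀ t k → (k ℤ.+ k) - t - k ≡ - (t - k)
  reflectAround = solve-∀

colourVal-injective : ∀ k {a b : Fin (suc (2 * k))} → colourVal k a ≡ colourVal k b → a ≡ b
colourVal-injective k {a} {b} eq = toℕ-injective (ZP.+-injective (begin
  + toℕ a                 ≡⟨ shift (+ toℕ a) (+ k) ⟩
  + toℕ a - + k ℤ.+ + k   ≡⟨ cong (ℤ._+ + k) eq ⟩
  + toℕ b - + k ℤ.+ + k   ≡⟨ shift (+ toℕ b) (+ k) ⟨
  + toℕ b                 ∎))
  where
  shift : ∀ x k → x ≡ x - k ℤ.+ k
  shift = solve-∀

signedEqual⇔reflect : ∀ k s (a b : Fin (suc (2 * k))) →
  colourVal k a ≡ (if s then - colourVal k b else colourVal k b) ⇔ reflect s a ≡ b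
signedEqual⇔reflect k false a b = mk⇔ (colourVal-injective k) (cong (colourVal k))
signedEqual⇔reflect k true  a b = mk⇔
  (λ eq → colourVal-injective k (begin
    colourVal k (opposite a) ≡⟨ colourVal-opposite k a ⟩
    - colourVal k a          ≡⟨ cong -_ eq ⟩
    - - colourVal k b        ≡⟨ ZP.neg-involutive _ ⟩
    colourVal k b            ∎))
  (λ eq → begin
    colourVal k a               ≡⟨ ZP.neg-involutive _ ⟨
    - - colourVal k a           ≡⟨ cong -_ (colourVal-opposite k a) ⟨
    - colourVal k (opposite a)  ≡⟨ cong (-_ ∘ colourVal k) eq ⟩
    - colourVal k b             ∎)

edgeOK≡compatible : ∀ k {N} (col : Vec (Fin (suc (2 * k))) N) x y s →
  edgeOK k col (x , y , s) ≡ compatible s (lookup col x) (lookup col y)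
edgeOK≡compatible k col x y s =
  cong not (does-⇔ (signedEqual⇔reflect k s (lookup col x) (lookup col y))
                   (colourVal k (lookup col x) ℤ.≟ _) (_ ≟ _))

-- Walks in the complete graph

isWalk : ∀ {c t} → Fin c → Vec (Fin c) t → Fin c → Bool
isWalk a []       b = compatible false a b
isWalk a (x ∷ xs) b = compatible false a x ∧ isWalk x xs b

walks : ∀ {c} → ℕ → Fin c → Fin c → ℕ
walks {c} t a b = ∑Vec c t (λ xs → indicator (isWalk a xs b))

walks-suc : ∀ {c} t (a b : Fin c) →
  walks (suc t) a b ≡ ∑[ x < c ] (indicator (compatible false a x) * walks t x b)
walks-suc {c} t a b = sum-cong-≗ (λ x → begin
  ∑Vec c t (λ xs → indicator (compatible false a x ∧ isWalk x xs b))
    ≡⟨ ∑Vec-cong c t (λ xs → indicator-∧ (compatible false a x) _) ⟩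
  ∑Vec c t (λ xs → indicator (compatible false a x) * indicator (isWalk x xs b))
    ≡⟨ *-distribˡ-∑Vec c t (indicator (compatible false a x)) (λ xs → indicator (isWalk x xs b)) ⟨
  indicator (compatible false a x) * walks t x b
    ∎)

walks-suc-+-walks : ∀ {c} t (a b : Fin c) → walks (suc t) a b + walks t a b ≡ ∑[ x < c ] walks t x b
walks-suc-+-walks t a b =
  trans (cong (_+ walks t a b) (walks-suc t a b)) (∑-except a (λ x → walks t x b))

∑-compatible : ∀ {d} (b : Fin (suc d)) → ∑[ x < suc d ] indicator (compatible false x b) ≡ d
∑-compatible {d}     Fin.zero    = trans (∑-const d 1) (*-identityʳ d)
∑-compatible {suc d} (Fin.suc b) = cong suc (∑-compatible b)

∑-walks : ∀ {d} t (b : Fin (suc d)) → ∑[ x < suc d ] walks t x b ≡ d ^ suc t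
∑-walks {d} zero b = trans (∑-compatible b) (sym (*-identityʳ d))
∑-walks {d} (suc t) b = +-cancelʳ-≡ T (∑[ x < suc d ] walks (suc t) x b) (d ^ suc (suc t)) (begin
  ∑[ x < suc d ] walks (suc t) x b + T              ≡⟨ ∑-distrib-+ (λ x → walks (suc t) x b) (λ x → walks t x b) ⟨
  ∑[ x < suc d ] (walks (suc t) x b + walks t x b)  ≡⟨ sum-cong-≗ (λ x → walks-suc-+-walks t x b) ⟩
  ∑[ x < suc d ] T                                  ≡⟨ ∑-const (suc d) T ⟩
  T + d * T                                         ≡⟨ +-comm T (d * T) ⟩
  d * T + T                                         ≡⟨ cong (λ z → d * z + T) (∑-walks t b) ⟩
  d ^ suc (suc t) + T                               ∎)
  where
  T = ∑[ x < suc d ] walks t x b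

pos-^ : ∀ m n → + (m ^ n) ≡ (+ m) ℤ.^ n
pos-^ m zero    = refl
pos-^ m (suc n) = trans (ZP.pos-* m (m ^ n)) (cong ((+ m) ℤ.*_) (pos-^ m n))

walks-closedForm : ∀ {d} t {a b : Fin (suc d)} → a ≢ b →
  + suc d ℤ.* + walks t a b ≡ (+ d) ℤ.^ suc t - (- + 1) ℤ.^ suc t
walks-closedForm {d} zero {a} {b} a≢b = begin
  + suc d ℤ.* + indicator (not (does (a ≟ b)))
    ≡⟨ cong (λ z → + suc d ℤ.* + indicator (not z)) (dec-false (a ≟ b) a≢b) ⟩
  + suc d ℤ.* + 1
    ≡⟨ cong (ℤ._* + 1) (ZP.pos-+ 1 d) ⟩
  (+ 1 ℤ.+ + d) ℤ.* + 1
    ≡⟨ base (+ d) ⟩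
  (+ d) ℤ.^ 1 - (- + 1) ℤ.^ 1
    ∎
  where
  base : ∀ D → (+ 1 ℤ.+ D) ℤ.* + 1 ≡ D ℤ.* + 1 - (- + 1) ℤ.* + 1
  base = solve-∀
walks-closedForm {d} (suc t) {a} {b} a≢b = begin
  C ℤ.* + w′                        ≡⟨ split C (+ w′) (+ w) ⟩
  C ℤ.* (+ w′ ℤ.+ + w) - C ℤ.* + w  ≡⟨ cong₂ (λ s r → C ℤ.* s - r) w′+w≡P (walks-closedForm t a≢b) ⟩
  C ℤ.* P - (P - E)                 ≡⟨ cong (λ z → z ℤ.* P - (P - E)) (ZP.pos-+ 1 d) ⟩
  (+ 1 ℤ.+ + d) ℤ.* P - (P - E)     ≡⟨ step (+ d) P E ⟩
  + d ℤ.* P - (- + 1) ℤ.* E         ∎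
  where
  C = + suc d
  P = (+ d) ℤ.^ suc t
  E = (- + 1) ℤ.^ suc t
  w′ = walks (suc t) a b
  w = walks t a b
  w′+w≡P : + w′ ℤ.+ + w ≡ P
  w′+w≡P = begin
    + w′ ℤ.+ + w   ≡⟨ ZP.pos-+ w′ w ⟨
    + (w′ + w)     ≡⟨ cong +_ (trans (walks-suc-+-walks t a b) (∑-walks t b)) ⟩
    + (d ^ suc t)  ≡⟨ pos-^ d (suc t) ⟩
    P              ∎
  split : ∀ C x y → C ℤ.* x ≡ C ℤ.* (x ℤ.+ y) - C ℤ.* y
  split = solve-∀
  step : ∀ D P E → (+ 1 ℤ.+ D) ℤ.* P - (P - E) ≡ D ℤ.* P - (- + 1) ℤ.* E
  step = solve-∀

walks≡gamma : ∀ k q {a b : Fin (suc (2 * k))} → a ≢ b → + walks (suc q) a b ≡ gamma (3 + q) k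
walks≡gamma k q {a} {b} a≢b = begin
  + w                                  ≡⟨ cong +_ (m*n/n≡m w c) ⟨
  + (w * c ℕ./ c)                      ≡⟨ ZP.*-identityˡ _ ⟨
  + (w * c) ℤ./ + c                    ≡⟨ cong (ℤ._/ + c) (trans (ZP.pos-* w c) (ZP.*-comm (+ w) (+ c))) ⟩
  (+ c ℤ.* + w) ℤ./ + c                ≡⟨ cong (ℤ._/ + c) (walks-closedForm (suc q) a≢b) ⟩
  gamma (3 + q) k                      ∎
  where
  c = suc (2 * k)
  w = walks (suc q) a b

-- Proper colourings of signed books

edgesOK : ∀ k {N} → Vec (Fin (suc (2 * k))) N → List (Fin N × Fin N × Bool) → Bool
edgesOK k col = foldr (λ e b → edgeOK k col e ∧ b) true

edgesOK-++ : ∀ k {N} (col : Vec (Fin (suc (2 * k))) N) xs ys →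
  edgesOK k col (xs ++ ys) ≡ edgesOK k col xs ∧ edgesOK k col ys
edgesOK-++ k col []       ys = refl
edgesOK-++ k col (e ∷ xs) ys =
  trans (cong (edgeOK k col e ∧_) (edgesOK-++ k col xs ys))
        (sym (∧-assoc (edgeOK k col e) (edgesOK k col xs) (edgesOK k col ys)))

indicator-edgesOK-concatMap : ∀ k {N} {B : Set} {n} (col : Vec (Fin (suc (2 * k))) N)
  (F : B → List (Fin N × Fin N × Bool)) (h : Fin n → B) →
  indicator (edgesOK k col (concatMap F (List.tabulate h))) ≡ ∏[ i < n ] indicator (edgesOK k col (F (h i)))
indicator-edgesOK-concatMap k {n = zero}  col F h = refl
indicator-edgesOK-concatMap k {n = suc n} col F h = begin
  indicator (edgesOK k col (F (h Fin.zero) ++ concatMap F (List.tabulate (h ∘ Fin.suc))))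
    ≡⟨ cong indicator (edgesOK-++ k col (F (h Fin.zero)) _) ⟩
  indicator (edgesOK k col (F (h Fin.zero)) ∧ edgesOK k col (concatMap F (List.tabulate (h ∘ Fin.suc))))
    ≡⟨ indicator-∧ (edgesOK k col (F (h Fin.zero))) _ ⟩
  indicator (edgesOK k col (F (h Fin.zero))) * indicator (edgesOK k col (concatMap F (List.tabulate (h ∘ Fin.suc))))
    ≡⟨ cong (_*_ (indicator (edgesOK k col (F (h Fin.zero))))) (indicator-edgesOK-concatMap k col F (h ∘ Fin.suc)) ⟩
  ∏[ i < suc n ] indicator (edgesOK k col (F (h i)))
    ∎

edgeOK-signed : ∀ k {N} (col : Vec (Fin (suc (2 * k))) N) {x y s s′} → s ≡ s′ →
  edgeOK k col (x , y , s) ≡ compatible s′ (lookup col x) (lookup col y)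
edgeOK-signed k col refl = edgeOK≡compatible k col _ _ _

signEdges : ∀ {V : Set} → (V → V → Bool) → List (V × V) → List (V × V × Bool)
signEdges s = map (λ (x , y) → (x , y , s x y))

edgesOK-positivePath : ∀ k {N t} (col : Vec (Fin (suc (2 * k))) (suc N)) (s : Fin (suc N) → Fin (suc N) → Bool) →
  (∀ x y → s (Fin.suc x) y ≡ false) → (x : Fin N) (g : Fin t → Fin N) (w : Fin (suc N)) →
  edgesOK k col (signEdges s (consecutive (Fin.suc x ∷ List.tabulate (Fin.suc ∘ g) ++ w ∷ [])))
    ≡ isWalk (lookup col (Fin.suc x)) (Vec.tabulate (λ j → lookup col (Fin.suc (g j)))) (lookup col w)
edgesOK-positivePath k {t = zero} col s positive x g w =
  trans (∧-identityʳ _) (edgeOK-signed k col (positive x w))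
edgesOK-positivePath k {t = suc t} col s positive x g w =
  cong₂ _∧_ (edgeOK-signed k col (positive x (Fin.suc (g Fin.zero))))
            (edgesOK-positivePath k col s positive (g Fin.zero) (g ∘ Fin.suc) w)

SignedOnFirstEdges : ∀ {m n} → (Fin n → Fin (bookV m n) → Fin (bookV m n) → Bool) → (Fin n → Bool) → Set
SignedOnFirstEdges {m} {n} negPath sgn =
  (∀ i y → negPath i (bU {m} {n}) y ≡ sgn i) × (∀ i x y → negPath i (Fin.suc x) y ≡ false)

edgesOK-page : ∀ k q n {negPath sgn} → SignedOnFirstEdges {3 + q} {n} negPath sgn →
  ∀ a b rest i →
  edgesOK k (a ∷ b ∷ rest) (signEdges (negPath i) (consecutive (cyclePath (3 + q) n i)))
    ≡ isWalk (reflect (sgn i) a) (page {n = n} rest i) b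
edgesOK-page k q n {negPath} {sgn} (first , others) a b rest i = begin
  edgesOK k col (path (map (bX {3 + q} {n} i) (List.allFin (suc q))))
    ≡⟨ cong (edgesOK k col ∘ path) (map-tabulate (λ j → j) (bX {3 + q} {n} i)) ⟩
  edgesOK k col (path (List.tabulate (bX {3 + q} {n} i)))
    ≡⟨ cong₂ _∧_
         (edgeOK-signed k col {bU {3 + q} {n}} {bX {3 + q} {n} i Fin.zero} (first i _))
         (edgesOK-positivePath k col (negPath i) (others i)
            (Fin.suc (combine i Fin.zero)) (λ j → Fin.suc (combine i (Fin.suc j))) (bV {3 + q} {n})) ⟩
  isWalk (reflect (sgn i) a) (page {n = n} rest i) b
    ∎
  where
  col = a ∷ b ∷ rest
  path : List (Fin (bookV (3 + q) n)) → List (Fin (bookV (3 + q) n) × Fin (bookV (3 + q) n) × Bool)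
  path xs = signEdges (negPath i) (consecutive (bU {3 + q} {n} ∷ xs ++ (bV {3 + q} {n}) ∷ []))

indicator-isProper-book : ∀ k q n {negPath sgn} negUV → SignedOnFirstEdges {3 + q} {n} negPath sgn →
  ∀ a b rest →
  indicator (isProper k (bookSigned (3 + q) n negPath negUV) (a ∷ b ∷ rest))
    ≡ indicator (compatible negUV a b) * ∏[ i < n ] indicator (isWalk (reflect (sgn i) a) (page {n = n} rest i) b)
indicator-isProper-book k q n {negPath} negUV signs a b rest =
  trans (indicator-∧ (edgeOK k col (bU {3 + q} {n} , bV {3 + q} {n} , negUV)) _)
        (cong₂ _*_ (cong indicator (edgeOK≡compatible k col (bU {3 + q} {n}) (bV {3 + q} {n}) negUV))
                   (trans (indicator-edgesOK-concatMap k col pageEdges (λ i → i))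
                          (∏-cong (λ i → cong indicator (edgesOK-page k q n {negPath} signs a b rest i)))))
  where
  col = a ∷ b ∷ rest
  pageEdges : Fin n → List (Fin (bookV (3 + q) n) × Fin (bookV (3 + q) n) × Bool)
  pageEdges i = signEdges (negPath i) (consecutive (cyclePath (3 + q) n i))

numColourings-bookSigned : ∀ k q n {negPath sgn} negUV → SignedOnFirstEdges {3 + q} {n} negPath sgn →
  numColourings k (bookSigned (3 + q) n negPath negUV)
    ≡ ∑[ a < suc (2 * k) ] ∑[ b < suc (2 * k) ]
        (indicator (compatible negUV a b) * ∏[ i < n ] walks (suc q) (reflect (sgn i) a) b)
numColourings-bookSigned k q n {negPath} {sgn} negUV signs =
  trans (sumList-allVecs c (bookV (3 + q) n) _) (sum-cong-≗ (λ a → sum-cong-≗ (λ b → begin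
    ∑Vec c (n * suc q) (λ rest → indicator (isProper k (bookSigned (3 + q) n negPath negUV) (a ∷ b ∷ rest)))
      ≡⟨ ∑Vec-cong c (n * suc q) (indicator-isProper-book k q n {negPath} negUV signs a b) ⟩
    ∑Vec c (n * suc q) (λ rest → indicator (compatible negUV a b) * ∏[ i < n ] walkOK a b i (page {n = n} rest i))
      ≡⟨ *-distribˡ-∑Vec c (n * suc q) (indicator (compatible negUV a b)) _ ⟨
    indicator (compatible negUV a b) * ∑Vec c (n * suc q) (λ rest → ∏[ i < n ] walkOK a b i (page {n = n} rest i))
      ≡⟨ cong (_*_ (indicator (compatible negUV a b))) (∑Vec-∏-pages c n (suc q) (walkOK a b)) ⟩
    indicator (compatible negUV a b) * ∏[ i < n ] walks (suc q) (reflect (sgn i) a) b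
      ∎)))
  where
  c = suc (2 * k)
  walkOK : Fin c → Fin c → Fin n → Vec (Fin c) (suc q) → ℕ
  walkOK a b i xs = indicator (isWalk (reflect (sgn i) a) xs b)

numColourings-bookσ : ∀ k q n l → l ≤ n →
  numColourings k (bookσ (3 + q) n l)
    ≡ ∑[ a < suc (2 * k) ] ∑[ b < suc (2 * k) ]
        (indicator (compatible false a b) * (walks (suc q) (opposite a) b ^ l * walks (suc q) a b ^ (n ∸ l)))
numColourings-bookσ k q n l l≤n =
  trans (numColourings-bookSigned k q n {sgn = λ i → does (toℕ i <? l)} false
           ((λ i y → ∧-identityʳ _) , (λ i x y → ∧-zeroʳ _)))
        (sum-cong-≗ (λ (a : Fin (suc (2 * k))) → sum-cong-≗ (λ (b : Fin (suc (2 * k))) →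
           cong (_*_ (indicator (compatible false a b))) (∏-below (λ s → walks (suc q) (reflect s a) b) l≤n))))

numColourings-bookUV : ∀ k q l →
  numColourings k (bookUV (3 + q) l)
    ≡ ∑[ a < suc (2 * k) ] ∑[ b < suc (2 * k) ] (indicator (compatible false a b) * walks (suc q) (opposite a) b ^ l)
numColourings-bookUV k q l = begin
  numColourings k (bookUV (3 + q) l)
    ≡⟨ numColourings-bookSigned k q l {sgn = λ _ → false} true ((λ _ _ → refl) , (λ _ _ _ → refl)) ⟩
  ∑[ a < c ] ∑[ b < c ] (indicator (compatible true a b) * ∏[ i < l ] walks (suc q) a b)
    ≡⟨ sum-cong-≗ (λ (a : Fin c) → sum-cong-≗ (λ (b : Fin c) →
         cong (_*_ (indicator (compatible true a b))) (∏-const l (walks (suc q) a b)))) ⟩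
  ∑[ a < c ] ∑[ b < c ] (indicator (compatible true a b) * walks (suc q) a b ^ l)
    ≡⟨ ∑-permute (λ a → ∑[ b < c ] (indicator (compatible true a b) * walks (suc q) a b ^ l)) (reverse {c}) ⟩
  ∑[ a < c ] ∑[ b < c ] (indicator (compatible true (opposite a) b) * walks (suc q) (opposite a) b ^ l)
    ≡⟨ sum-cong-≗ (λ (a : Fin c) → sum-cong-≗ (λ (b : Fin c) →
         cong (λ x → indicator (not (does (x ≟ b))) * walks (suc q) (opposite a) b ^ l) (opposite-involutive a))) ⟩
  ∑[ a < c ] ∑[ b < c ] (indicator (compatible false a b) * walks (suc q) (opposite a) b ^ l)
    ∎
  where
  c = suc (2 * k)

σ-term≡scaled-uv-term : ∀ k q l e (a b : Fin (suc (2 * k))) →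
  + (indicator (compatible false a b) * (walks (suc q) (opposite a) b ^ l * walks (suc q) a b ^ e))
    ≡ gamma (3 + q) k ℤ.^ e ℤ.* + (indicator (compatible false a b) * walks (suc q) (opposite a) b ^ l)
σ-term≡scaled-uv-term k q l e a b with a ≟ b
... | yes _  = sym (ZP.*-zeroʳ (gamma (3 + q) k ℤ.^ e))
... | no a≢b = begin
  + (1 * (x * w ^ e))       ≡⟨ cong +_ (*-identityˡ (x * w ^ e)) ⟩
  + (x * w ^ e)             ≡⟨ ZP.pos-* x (w ^ e) ⟩
  + x ℤ.* + (w ^ e)         ≡⟨ cong (+ x ℤ.*_) (trans (pos-^ w e) (cong (ℤ._^ e) (walks≡gamma k q a≢b))) ⟩
  + x ℤ.* γ ℤ.^ e           ≡⟨ ZP.*-comm (+ x) (γ ℤ.^ e) ⟩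
  γ ℤ.^ e ℤ.* + x           ≡⟨ cong (λ z → γ ℤ.^ e ℤ.* + z) (*-identityˡ x) ⟨
  γ ℤ.^ e ℤ.* + (1 * x)     ∎
  where
  x = walks (suc q) (opposite a) b ^ l
  w = walks (suc q) a b
  γ = gamma (3 + q) k

theorem3p9 : (m n l : ℕ) → 3 ≤ m → 3 ≤ n → 2 ≤ l → l ≤ n ∸ 1 →
    (k : ℕ) →
      + numColourings k (bookσ m n l) ≡ (gamma m k ℤ.^ (n ∸ l)) ℤ.* (+ numColourings k (bookUV m l))
theorem3p9 (suc (suc (suc q))) n l (s≤s (s≤s (s≤s z≤n))) _ _ l≤n∸1 k = begin
  + numColourings k (bookσ (3 + q) n l)
    ≡⟨ cong +_ (numColourings-bookσ k q n l (≤-trans l≤n∸1 (m∸n≤m n 1))) ⟩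
  + ∑[ a < c ] ∑[ b < c ] (indicator (compatible false a b) * (W (opposite a) b ^ l * W a b ^ (n ∸ l)))
    ≡⟨ pos-∑-scale γᵉ (λ a → pos-∑-scale γᵉ (σ-term≡scaled-uv-term k q l (n ∸ l) a)) ⟩
  γᵉ ℤ.* + ∑[ a < c ] ∑[ b < c ] (indicator (compatible false a b) * W (opposite a) b ^ l)
    ≡⟨ cong (λ z → γᵉ ℤ.* + z) (numColourings-bookUV k q l) ⟨
  γᵉ ℤ.* + numColourings k (bookUV (3 + q) l)
    ∎
  where
  c = suc (2 * k)
  W : Fin c → Fin c → ℕ
  W = walks (suc q)
  γᵉ = gamma (3 + q) k ℤ.^ (n ∸ l)
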